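{- Let $N\ge1$ and $\mathbf k=(k_0,\ldots,k_{N-1})$, $\boldsymbol\ell=(\ell_0,\ldots,\ell_{N-1})\in\overline{\mathbb N}_+^N$. (i) If $\ell_0=\cdots=\ell_{N-1}=\infty$, then $\gamma_{\mathbf k\ast\boldsymbol\ell}=\gamma_{\sigma\mathbf k\ast\boldsymbol\ell}$ for every permutation $\sigma$ of $\{0,\ldots,N-1\}$. (ii) If $k_0=\cdots=k_{N-1}=\infty$, then $\gamma_{\mathbf k\ast\boldsymbol\ell}=\gamma_{\mathbf k\ast\sigma\boldsymbol\ell}$ for every permutation $\sigma$ of $\{0,\ldots,N-1\}$ with $\sigma(N-1)=N-1$. These are identities of formal power series in $\alpha,\beta$.
   Context: Let $\overline{\mathbb N}_+=\{1,2,3,\ldots\}\cup\{\infty\}$. Let $\alpha,\beta$ be formal variables, $A_0=\begin{pmatrix}1&0\\ \alpha&\beta\end{pmatrix}$, $A_1=\begin{pmatrix}\alpha&\beta\\0&1\end{pmatrix}$ over $\mathbb C[[\alpha,\beta]]$, with usual powers for finite exponents and $A_0^\infty=\begin{pmatrix}1&0\\ \frac{\alpha}{1-\beta}&0\end{pmatrix}$, $A_1^\infty=\begin{pmatrix}0&\frac{\beta}{1-\alpha}\\0&1\end{pmatrix}$. For $\mathbf t=(t_0,t_1,\ldots,t_{2N-1})\in\overline{\mathbb N}_+^{2N}$, $\gamma_{\mathbf t}(\alpha,\beta)$ is the top-left entry of $A_1^{t_0}A_0^{t_1}A_1^{t_2}A_0^{t_3}\cdots A_1^{t_{2N-2}}A_0^{t_{2N-1}}$.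 The interleaving is $(k_0,\ldots,k_{N-1})\ast(\ell_0,\ldots,\ell_{N-1})=(k_0,\ell_0,k_1,\ell_1,\ldots,k_{N-1},\ell_{N-1})$, and $\sigma\mathbf k=(k_{\sigma^{ -1}(0)},\ldots,k_{\sigma^{ -1}(N-1)})$. -}

module Defs where

open import Data.Nat using (ℕ; zero; suc)
open import Data.Integer using (ℤ; 0ℤ; 1ℤ) renaming (_+_ to _+ℤ_; _*_ to _*ℤ_)
open import Data.Fin using (Fin)
open import Data.List using (List; []; _∷_; _++_; concatMap)
open import Data.List.Base using (allFin)
open import Relation.Binary.PropositionalEquality using (_≡_)

-- Formal power series in two commuting variables α, β with integer
-- coefficients:  f i j  is the coefficient of α^i β^j.
FPS : Set
FPS = ℕ → ℕ → ℤ

_≈ₛ_ : FPS → FPS → Set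
f ≈ₛ g = ∀ i j → f i j ≡ g i j

sumTo : ℕ → (ℕ → ℤ) → ℤ
sumTo zero f = f zero
sumTo (suc n) f = sumTo n f +ℤ f (suc n)

_-ₙ_ : ℕ → ℕ → ℕ
m -ₙ zero = m
zero -ₙ suc n = zero
suc m -ₙ suc n = m -ₙ n

0ₛ 1ₛ α β : FPS
0ₛ i j = 0ℤ
1ₛ zero zero = 1ℤ
1ₛ _ _ = 0ℤ
α (suc zero) zero = 1ℤ
α _ _ = 0ℤ
β zero (suc zero) = 1ℤ
β _ _ = 0ℤ

_+ₛ_ : FPS → FPS → FPS
(f +ₛ g) i j = f i j +ℤ g i j

_*ₛ_ : FPS → FPS → FPS
(f *ₛ g) i j = sumTo i (λ a → sumTo j (λ b → f a b *ℤ g (i -ₙ a) (j -ₙ b)))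

-- 1/(1-β) = Σ_n β^n  and  1/(1-α) = Σ_n α^n
inv1-β inv1-α : FPS
inv1-β zero j = 1ℤ
inv1-β (suc i) j = 0ℤ
inv1-α i zero = 1ℤ
inv1-α i (suc j) = 0ℤ

-- 2×2 matrices over FPS:  [[ a , b ] , [ c , d ]]
record M2 : Set where
  constructor mat
  field a b c d : FPS
open M2 public

_⊗_ : M2 → M2 → M2
mat a₁ b₁ c₁ d₁ ⊗ mat a₂ b₂ c₂ d₂ =
  mat ((a₁ *ₛ a₂) +ₛ (b₁ *ₛ c₂)) ((a₁ *ₛ b₂) +ₛ (b₁ *ₛ d₂))
      ((c₁ *ₛ a₂) +ₛ (d₁ *ₛ c₂)) ((c₁ *ₛ b₂) +ₛ (d₁ *ₛ d₂))

I₂ : M2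
I₂ = mat 1ₛ 0ₛ 0ₛ 1ₛ

A₀ A₁ A₀∞ A₁∞ : M2
A₀ = mat 1ₛ 0ₛ α β
A₁ = mat α β 0ₛ 1ₛ
A₀∞ = mat 1ₛ 0ₛ (α *ₛ inv1-β) 0ₛ
A₁∞ = mat 0ₛ (β *ₛ inv1-α) 0ₛ 1ₛ

-- \overline{ℕ}_+ = {1,2,3,...} ∪ {∞};  fin⁺ n  denotes the positive integer n+1
data ℕ⁺∞ : Set where
  fin⁺ : ℕ → ℕ⁺∞
  ∞ : ℕ⁺∞

_^ₘ_ : M2 → ℕ → M2
A ^ₘ zero = I₂
A ^ₘ suc n = A ⊗ (A ^ₘ n)

pow₀ pow₁ : ℕ⁺∞ → M2
pow₀ (fin⁺ n) = A₀ ^ₘ suc n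
pow₀ ∞ = A₀∞
pow₁ (fin⁺ n) = A₁ ^ₘ suc n
pow₁ ∞ = A₁∞

prodFrom₁ prodFrom₀ : List ℕ⁺∞ → M2
prodFrom₁ [] = I₂
prodFrom₁ (t ∷ ts) = pow₁ t ⊗ prodFrom₀ ts
prodFrom₀ [] = I₂
prodFrom₀ (t ∷ ts) = pow₀ t ⊗ prodFrom₁ ts

-- γ_t : top-left entry (intended for lists of even length 2N)
γ : List ℕ⁺∞ → FPS
γ ts = a (prodFrom₁ ts)

_∗_ : ∀ {N} → (Fin N → ℕ⁺∞) → (Fin N → ℕ⁺∞) → List ℕ⁺∞
_∗_ {N} k ℓ = concatMap (λ i → k i ∷ ℓ i ∷ []) (allFin N)

module Submission where

open import Defs
open import Data.Nat using (ℕ; suc)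
open import Data.Fin using (Fin; fromℕ)
open import Data.Fin.Permutation using (Permutation′; _⟨$⟩ʳ_; _⟨$⟩ˡ_)
open import Data.Product using (_×_)
open import Relation.Binary.PropositionalEquality using (_≡_)

open import Level using (0ℓ)
open import Data.Nat using (zero; _∸_; _≤_; z≤n) renaming (_+_ to _+ℕ_)
open import Data.Nat.Properties
  using (≤-refl; m≤n⇒m≤1+n; +-suc; n∸n≡0; +-∸-assoc; m+[n∸m]≡n;
         m∸[m∸n]≡n; m+n∸m≡n; ∸-+-assoc)
  renaming (+-identityʳ to +ℕ-identityʳ)
import Data.Integer.Properties as ℤ
open import Data.Integer using () renaming (_+_ to _+ℤ_; _*_ to _*ℤ_)
open import Data.Bool using (Bool; true; false)
open import Data.Fin using () renaming (zero to 0F; suc to sucF; _≟_ to _≟F_)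
open import Data.Fin.Permutation using (inverseˡ; inverseʳ)
open import Data.List using (List; []; _∷_; concat)
open import Data.List.Properties using (map-tabulate)
open import Data.Product using (_,_)
open import Function using (_∘_; mk⇔)
open import Relation.Nullary using (does)
open import Relation.Nullary.Decidable using (does-⇔)
import Relation.Binary.PropositionalEquality as ≡
open import Algebra.Core using (Op₂)
open import Algebra.Bundles using (CommutativeSemiring)
open import Algebra.Structures using (IsCommutativeSemiring; IsCommutativeMonoid)
import Algebra.Construct.Pointwise as Pointwise
import Algebra.Consequences.Setoid as Consequences
import Algebra.Properties.CommutativeSemigroup as CommutativeSemigroupProperties
import Algebra.Properties.CommutativeMonoid.Sum as MonoidSum
import Algebra.Structures.Biased as Biased

-- Both parts come from the shape of the limit matrices.  A₀^∞ has zero second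
-- column, so every block A₁^{k} A₀^∞ has the form [[x, 0], [y, 0]], and the
-- top-left entry of a product of such blocks is the product of their
-- top-left entries x, which is symmetric in the blocks.  Dually A₁^∞ has zero
-- first column, so after the leading A₁^∞ the product splits into blocks
-- A₀^{ℓ} A₁^∞ of the form [[0, u], [0, v]] followed by A₀^{ℓ_{N-1}}; the
-- relevant entry is then b(A₁^∞) · v(ℓ₀) ⋯ v(ℓ_{N-2}) · c(A₀^{ℓ_{N-1}}),
-- symmetric in every ℓᵢ but the last.  The only algebra needed is that
-- ℤ[[α, β]] = ℤ[[β]][[α]] is a commutative semiring.

isCommutativeSemiring-replace-* : ∀ {c r} (R : CommutativeSemiring c r) →
  let open CommutativeSemiring R in
  {_*′_ : Op₂ Carrier} {1′ : Carrier} →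
  (∀ x y → (x *′ y) ≈ (x * y)) → 1′ ≈ 1# → IsCommutativeSemiring _≈_ _+_ _*′_ 0# 1′
isCommutativeSemiring-replace-* R {_*′_} {1′} *′≈* 1′≈1 = record
  { isSemiring = record
    { isSemiringWithoutAnnihilatingZero = record
      { +-isCommutativeMonoid = +-isCommutativeMonoid
      ; *-cong = λ {x} {x′} {y} {y′} x≈x′ y≈y′ →
          trans (*′≈* x y) (trans (*-cong x≈x′ y≈y′) (sym (*′≈* x′ y′)))
      ; *-assoc = λ x y z → begin
          (x *′ y) *′ z  ≈⟨ *′≈* _ z ⟩
          (x *′ y) * z   ≈⟨ *-congʳ (*′≈* x y) ⟩
          (x * y) * z    ≈⟨ *-assoc x y z ⟩
          x * (y * z)    ≈⟨ *-congˡ (*′≈* y z) ⟨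
          x * (y *′ z)   ≈⟨ *′≈* x _ ⟨
          x *′ (y *′ z)  ∎
      ; *-identity = (λ x → trans (*′≈* 1′ x) (trans (*-congʳ 1′≈1) (*-identityˡ x)))
                   , (λ x → trans (*′≈* x 1′) (trans (*-congˡ 1′≈1) (*-identityʳ x)))
      ; distrib = (λ x y z → trans (*′≈* x (y + z))
                     (trans (distribˡ x y z) (sym (+-cong (*′≈* x y) (*′≈* x z)))))
                , (λ z x y → trans (*′≈* (x + y) z)
                     (trans (distribʳ z x y) (sym (+-cong (*′≈* x z) (*′≈* y z)))))
      }
    ; zero = (λ x → trans (*′≈* 0# x) (zeroˡ x)) , (λ x → trans (*′≈* x 0#) (zeroʳ x))
    }
  ; *-comm = λ x y → trans (*′≈* x y) (trans (*-comm x y) (sym (*′≈* y x)))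
  }
  where
  open CommutativeSemiring R
  open import Relation.Binary.Reasoning.Setoid setoid

module PowerSeries {c r} (R : CommutativeSemiring c r) where
  open CommutativeSemiring R hiding (zero)
  open CommutativeSemigroupProperties +-commutativeSemigroup using (interchange)
  open import Relation.Binary.Reasoning.Setoid setoid

  ∑≤ : ℕ → (ℕ → Carrier) → Carrier
  ∑≤ zero f = f zero
  ∑≤ (suc n) f = ∑≤ n f + f (suc n)

  ∑≤-cong : ∀ n {f g} → (∀ a → a ≤ n → f a ≈ g a) → ∑≤ n f ≈ ∑≤ n g
  ∑≤-cong zero f≈g = f≈g zero z≤n
  ∑≤-cong (suc n) f≈g =
    +-cong (∑≤-cong n (λ a a≤n → f≈g a (m≤n⇒m≤1+n a≤n))) (f≈g (suc n) ≤-refl)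

  ∑≤-distrib-+ : ∀ n f g → ∑≤ n (λ a → f a + g a) ≈ ∑≤ n f + ∑≤ n g
  ∑≤-distrib-+ zero f g = refl
  ∑≤-distrib-+ (suc n) f g = trans (+-congʳ (∑≤-distrib-+ n f g)) (interchange _ _ _ _)

  *-distribˡ-∑≤ : ∀ n x f → x * ∑≤ n f ≈ ∑≤ n (λ a → x * f a)
  *-distribˡ-∑≤ zero x f = refl
  *-distribˡ-∑≤ (suc n) x f = trans (distribˡ x _ _) (+-congʳ (*-distribˡ-∑≤ n x f))

  *-distribʳ-∑≤ : ∀ n x f → ∑≤ n f * x ≈ ∑≤ n (λ a → f a * x)
  *-distribʳ-∑≤ zero x f = refl
  *-distribʳ-∑≤ (suc n) x f = trans (distribʳ x _ _) (+-congʳ (*-distribʳ-∑≤ n x f))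

  ∑≤-zero : ∀ n {f} → (∀ a → f a ≈ 0#) → ∑≤ n f ≈ 0#
  ∑≤-zero zero f≈0 = f≈0 zero
  ∑≤-zero (suc n) f≈0 = trans (+-cong (∑≤-zero n f≈0) (f≈0 (suc n))) (+-identityʳ 0#)

  ∑≤-suc : ∀ n f → ∑≤ (suc n) f ≈ f zero + ∑≤ n (f ∘ suc)
  ∑≤-suc zero f = refl
  ∑≤-suc (suc n) f = trans (+-congʳ (∑≤-suc n f)) (+-assoc _ _ _)

  ∑≤-reverse : ∀ n f → ∑≤ n f ≈ ∑≤ n (λ a → f (n ∸ a))
  ∑≤-reverse zero f = refl
  ∑≤-reverse (suc n) f = begin
    ∑≤ n f + f (suc n)                     ≈⟨ +-comm _ _ ⟩
    f (suc n) + ∑≤ n f                     ≈⟨ +-congˡ (∑≤-reverse n f) ⟩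
    f (suc n) + ∑≤ n (λ a → f (n ∸ a))     ≈⟨ ∑≤-suc n (λ a → f (suc n ∸ a)) ⟨
    ∑≤ (suc n) (λ a → f (suc n ∸ a))       ∎

  ∑≤-triangle : ∀ n (F : ℕ → ℕ → Carrier) →
    ∑≤ n (λ a → ∑≤ a (F a)) ≈ ∑≤ n (λ b → ∑≤ (n ∸ b) (λ c → F (b +ℕ c) b))
  ∑≤-triangle zero F = refl
  ∑≤-triangle (suc n) F = begin
    ∑≤ n (λ a → ∑≤ a (F a)) + ∑≤ (suc n) (F (suc n))
      ≈⟨ +-congʳ (∑≤-triangle n F) ⟩
    ∑≤ n (λ b → ∑≤ (n ∸ b) (G b)) + (∑≤ n (F (suc n)) + F (suc n) (suc n))
      ≈⟨ +-assoc _ _ _ ⟨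
    (∑≤ n (λ b → ∑≤ (n ∸ b) (G b)) + ∑≤ n (F (suc n))) + F (suc n) (suc n)
      ≈⟨ +-cong (∑≤-distrib-+ n _ _) diagonal ⟨
    ∑≤ n (λ b → ∑≤ (n ∸ b) (G b) + F (suc n) b) + ∑≤ (n ∸ n) (G (suc n))
      ≈⟨ +-congʳ (∑≤-cong n extend) ⟩
    ∑≤ (suc n) (λ b → ∑≤ (suc n ∸ b) (G b))
      ∎
    where
    G : ℕ → ℕ → Carrier
    G b c = F (b +ℕ c) b
    diagonal : ∑≤ (n ∸ n) (G (suc n)) ≈ F (suc n) (suc n)
    diagonal = reflexive (≡.trans (≡.cong (λ m → ∑≤ m (G (suc n))) (n∸n≡0 n))
                                  (≡.cong (λ m → F m (suc n)) (+ℕ-identityʳ (suc n))))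
    extend : ∀ b → b ≤ n → ∑≤ (n ∸ b) (G b) + F (suc n) b ≈ ∑≤ (suc n ∸ b) (G b)
    extend b b≤n = reflexive (≡.trans
      (≡.cong (λ m → ∑≤ (n ∸ b) (G b) + F m b)
              (≡.sym (≡.trans (+-suc b (n ∸ b)) (≡.cong suc (m+[n∸m]≡n b≤n)))))
      (≡.cong (λ m → ∑≤ m (G b)) (≡.sym (+-∸-assoc 1 b≤n))))

  Series : Set c
  Series = ℕ → Carrier

  _≋_ : Series → Series → Set r
  f ≋ g = ∀ n → f n ≈ g n

  _⊕_ : Series → Series → Series
  (f ⊕ g) n = f n + g n

  _⋆_ : Series → Series → Series
  (f ⋆ g) n = ∑≤ n (λ a → f a * g (n ∸ a))

  𝟘 𝟙 : Series
  𝟘 _ = 0#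
  𝟙 zero = 1#
  𝟙 (suc _) = 0#

  ⊕-isCommutativeMonoid : IsCommutativeMonoid _≋_ _⊕_ 𝟘
  ⊕-isCommutativeMonoid = Pointwise.isCommutativeMonoid ℕ +-isCommutativeMonoid

  open IsCommutativeMonoid ⊕-isCommutativeMonoid using () renaming (setoid to ≋-setoid)

  ⋆-cong : ∀ {f f′ g g′} → f ≋ f′ → g ≋ g′ → (f ⋆ g) ≋ (f′ ⋆ g′)
  ⋆-cong f≋f′ g≋g′ n = ∑≤-cong n (λ a _ → *-cong (f≋f′ a) (g≋g′ (n ∸ a)))

  ⋆-comm : ∀ f g → (f ⋆ g) ≋ (g ⋆ f)
  ⋆-comm f g n = trans (∑≤-reverse n _) (∑≤-cong n (λ a a≤n →
    trans (*-comm _ _) (*-congʳ (reflexive (≡.cong g (m∸[m∸n]≡n a≤n))))))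

  ⋆-assoc : ∀ f g h → ((f ⋆ g) ⋆ h) ≋ (f ⋆ (g ⋆ h))
  ⋆-assoc f g h n = begin
    ∑≤ n (λ a → ∑≤ a (λ b → f b * g (a ∸ b)) * h (n ∸ a))
      ≈⟨ ∑≤-cong n (λ a _ → *-distribʳ-∑≤ a _ _) ⟩
    ∑≤ n (λ a → ∑≤ a (λ b → f b * g (a ∸ b) * h (n ∸ a)))
      ≈⟨ ∑≤-triangle n (λ a b → f b * g (a ∸ b) * h (n ∸ a)) ⟩
    ∑≤ n (λ b → ∑≤ (n ∸ b) (λ c → f b * g (b +ℕ c ∸ b) * h (n ∸ (b +ℕ c))))
      ≈⟨ ∑≤-cong n (λ b _ → ∑≤-cong (n ∸ b) (λ c _ → trans
           (*-cong (*-congˡ (reflexive (≡.cong g (m+n∸m≡n b c))))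
                   (reflexive (≡.cong h (≡.sym (∸-+-assoc n b c)))))
           (*-assoc _ _ _))) ⟩
    ∑≤ n (λ b → ∑≤ (n ∸ b) (λ c → f b * (g c * h (n ∸ b ∸ c))))
      ≈⟨ ∑≤-cong n (λ b _ → *-distribˡ-∑≤ (n ∸ b) _ _) ⟨
    ∑≤ n (λ b → f b * ∑≤ (n ∸ b) (λ c → g c * h (n ∸ b ∸ c)))
      ∎

  ⋆-identityˡ : ∀ f → (𝟙 ⋆ f) ≋ f
  ⋆-identityˡ f zero = *-identityˡ _
  ⋆-identityˡ f (suc n) = trans (∑≤-suc n _)
    (trans (+-cong (*-identityˡ _) (∑≤-zero n (λ a → zeroˡ _))) (+-identityʳ _))

  ⋆-zeroˡ : ∀ f → (𝟘 ⋆ f) ≋ 𝟘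
  ⋆-zeroˡ f n = ∑≤-zero n (λ a → zeroˡ _)

  ⋆-distribʳ : ∀ h f g → ((f ⊕ g) ⋆ h) ≋ ((f ⋆ h) ⊕ (g ⋆ h))
  ⋆-distribʳ h f g n = trans (∑≤-cong n (λ a _ → distribʳ _ _ _)) (∑≤-distrib-+ n _ _)

  commutativeSemiring : CommutativeSemiring c r
  commutativeSemiring = record
    { isCommutativeSemiring = Biased.isCommutativeSemiringˡ record
      { +-isCommutativeMonoid = ⊕-isCommutativeMonoid
      ; *-isCommutativeMonoid = record
        { isMonoid = record
          { isSemigroup = record
            { isMagma = record
              { isEquivalence = IsCommutativeMonoid.isEquivalence ⊕-isCommutativeMonoid
              ; ∙-cong = ⋆-cong
              }
            ; assoc = ⋆-assoc
            }
          ; identity = Consequences.comm∧idˡ⇒id ≋-setoid ⋆-comm ⋆-identityˡ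
          }
        ; comm = ⋆-comm
        }
      ; distribʳ = ⋆-distribʳ
      ; zeroˡ = ⋆-zeroˡ
      }
    }

-- FPS is ℤ[[β]][[α]]: the outer index is the exponent of α.
module ℤ[[β]] = PowerSeries ℤ.+-*-commutativeSemiring
module ℤ[[β]][[α]] = PowerSeries ℤ[[β]].commutativeSemiring

-ₙ≡∸ : ∀ m n → m -ₙ n ≡ m ∸ n
-ₙ≡∸ m zero = ≡.refl
-ₙ≡∸ zero (suc n) = ≡.refl
-ₙ≡∸ (suc m) (suc n) = -ₙ≡∸ m n

sumTo≡∑≤ : ∀ n f → sumTo n f ≡ ℤ[[β]].∑≤ n f
sumTo≡∑≤ zero f = ≡.refl
sumTo≡∑≤ (suc n) f = ≡.cong (_+ℤ f (suc n)) (sumTo≡∑≤ n f)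

∑≤-coefficient : ∀ n F j → ℤ[[β]][[α]].∑≤ n F j ≡ ℤ[[β]].∑≤ n (λ a → F a j)
∑≤-coefficient zero F j = ≡.refl
∑≤-coefficient (suc n) F j = ≡.cong (_+ℤ F (suc n) j) (∑≤-coefficient n F j)

*ₛ≈⋆ : ∀ f g → (f *ₛ g) ≈ₛ (f ℤ[[β]][[α]].⋆ g)
*ₛ≈⋆ f g i j = ≡.trans (sumTo≡∑≤ i _) (≡.trans
  (ℤ[[β]].∑≤-cong i (λ a _ → ≡.trans (sumTo≡∑≤ j _) (ℤ[[β]].∑≤-cong j (λ b _ →
     ≡.cong₂ (λ x y → f a b *ℤ g x y) (-ₙ≡∸ i a) (-ₙ≡∸ j b)))))
  (≡.sym (∑≤-coefficient i _ j)))

1ₛ≈𝟙 : 1ₛ ≈ₛ ℤ[[β]][[α]].𝟙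
1ₛ≈𝟙 zero zero = ≡.refl
1ₛ≈𝟙 zero (suc j) = ≡.refl
1ₛ≈𝟙 (suc i) j = ≡.refl

FPS-commutativeSemiring : CommutativeSemiring 0ℓ 0ℓ
FPS-commutativeSemiring = record
  { Carrier = FPS ; _≈_ = _≈ₛ_ ; _+_ = _+ₛ_ ; _*_ = _*ₛ_ ; 0# = 0ₛ ; 1# = 1ₛ
  ; isCommutativeSemiring =
      isCommutativeSemiring-replace-* ℤ[[β]][[α]].commutativeSemiring *ₛ≈⋆ 1ₛ≈𝟙
  }

open CommutativeSemiring FPS-commutativeSemiring hiding (zero; Carrier)
open MonoidSum *-commutativeMonoid using (sum-cong-≗) renaming (sum to ∏; sum-permute to ∏-permute)
open import Relation.Binary.Reasoning.Setoid setoid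

∏-reindex : ∀ {n} (f : Fin n → FPS) (σ : Permutation′ n) → ∏ (f ∘ (σ ⟨$⟩ˡ_)) ≈ ∏ f
∏-reindex {n} f σ = trans (∏-permute _ σ) (reflexive (sum-cong-≗ {n} (λ i → ≡.cong f (inverseˡ σ))))

∗-unfold : ∀ {m} (k ℓ : Fin (suc m) → ℕ⁺∞) →
  k ∗ ℓ ≡ k 0F ∷ ℓ 0F ∷ (k ∘ sucF) ∗ (ℓ ∘ sucF)
∗-unfold {m} k ℓ = ≡.cong (λ tss → k 0F ∷ ℓ 0F ∷ concat tss)
  (≡.trans (map-tabulate sucF pair) (≡.sym (map-tabulate (λ i → i) (pair ∘ sucF))))
  where
  pair : Fin (suc m) → List ℕ⁺∞
  pair i = k i ∷ ℓ i ∷ []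

a-A₀∞⊗ : ∀ M → a (A₀∞ ⊗ M) ≈ a M
a-A₀∞⊗ M = trans (+-cong (*-identityˡ (a M)) (zeroˡ (c M))) (+-identityʳ (a M))

c-A₀∞⊗ : ∀ M → c (A₀∞ ⊗ M) ≈ c A₀∞ * a M
c-A₀∞⊗ M = trans (+-congˡ {c A₀∞ * a M} (zeroˡ (c M))) (+-identityʳ (c A₀∞ * a M))

a-A₁∞⊗ : ∀ M → a (A₁∞ ⊗ M) ≈ b A₁∞ * c M
a-A₁∞⊗ M = trans (+-congʳ {b A₁∞ * c M} (zeroˡ (a M))) (+-identityˡ (b A₁∞ * c M))

c-A₁∞⊗ : ∀ M → c (A₁∞ ⊗ M) ≈ c M
c-A₁∞⊗ M = trans (+-cong (zeroˡ (a M)) (*-identityˡ (c M))) (+-identityˡ (c M))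

c-⊗I₂ : ∀ P → c (P ⊗ I₂) ≈ c P
c-⊗I₂ P = trans (+-cong (*-identityʳ (c P)) (zeroʳ (d P))) (+-identityʳ (c P))

a-⊗A₀∞⊗ : ∀ P M → a (P ⊗ (A₀∞ ⊗ M)) ≈ (a P + b P * c A₀∞) * a M
a-⊗A₀∞⊗ P M = begin
  a P * a (A₀∞ ⊗ M) + b P * c (A₀∞ ⊗ M)  ≈⟨ +-cong (*-congˡ {a P} (a-A₀∞⊗ M)) (*-congˡ {b P} (c-A₀∞⊗ M)) ⟩
  a P * a M + b P * (c A₀∞ * a M)        ≈⟨ +-congˡ {a P * a M} (*-assoc (b P) (c A₀∞) (a M)) ⟨
  a P * a M + (b P * c A₀∞) * a M        ≈⟨ distribʳ (a M) (a P) (b P * c A₀∞) ⟨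
  (a P + b P * c A₀∞) * a M              ∎

topLeft-A₁A₀∞ : ℕ⁺∞ → FPS
topLeft-A₁A₀∞ k = a (pow₁ k) + b (pow₁ k) * c A₀∞

prod-∗-all-∞ʳ : ∀ {m} (k ℓ : Fin (suc m) → ℕ⁺∞) → (∀ i → ℓ i ≡ ∞) →
  prodFrom₁ (k ∗ ℓ) ≡ pow₁ (k 0F) ⊗ (A₀∞ ⊗ prodFrom₁ ((k ∘ sucF) ∗ (ℓ ∘ sucF)))
prod-∗-all-∞ʳ k ℓ ℓ≡∞ = ≡.trans (≡.cong prodFrom₁ (∗-unfold k ℓ))
  (≡.cong (λ t → pow₁ (k 0F) ⊗ (pow₀ t ⊗ prodFrom₁ ((k ∘ sucF) ∗ (ℓ ∘ sucF)))) (ℓ≡∞ 0F))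

γ-∗-all-∞ʳ : ∀ {N} (k ℓ : Fin N → ℕ⁺∞) → (∀ i → ℓ i ≡ ∞) →
  γ (k ∗ ℓ) ≈ ∏ (topLeft-A₁A₀∞ ∘ k)
γ-∗-all-∞ʳ {zero} k ℓ ℓ≡∞ = refl
γ-∗-all-∞ʳ {suc N} k ℓ ℓ≡∞ = begin
  γ (k ∗ ℓ)                                ≡⟨ ≡.cong a (prod-∗-all-∞ʳ k ℓ ℓ≡∞) ⟩
  a (pow₁ (k 0F) ⊗ (A₀∞ ⊗ M))              ≈⟨ a-⊗A₀∞⊗ (pow₁ (k 0F)) M ⟩
  topLeft-A₁A₀∞ (k 0F) * a M
    ≈⟨ *-congˡ {topLeft-A₁A₀∞ (k 0F)} (γ-∗-all-∞ʳ (k ∘ sucF) (ℓ ∘ sucF) (ℓ≡∞ ∘ sucF)) ⟩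
  ∏ (topLeft-A₁A₀∞ ∘ k)                    ∎
  where
  M = prodFrom₁ ((k ∘ sucF) ∗ (ℓ ∘ sucF))

γ-∗-permuteˡ : ∀ {N} (k ℓ : Fin N → ℕ⁺∞) → (∀ i → ℓ i ≡ ∞) → (σ : Permutation′ N) →
  γ (k ∗ ℓ) ≈ γ ((λ j → k (σ ⟨$⟩ˡ j)) ∗ ℓ)
γ-∗-permuteˡ k ℓ ℓ≡∞ σ = begin
  γ (k ∗ ℓ)                             ≈⟨ γ-∗-all-∞ʳ k ℓ ℓ≡∞ ⟩
  ∏ (topLeft-A₁A₀∞ ∘ k)                 ≈⟨ ∏-reindex (topLeft-A₁A₀∞ ∘ k) σ ⟨
  ∏ (topLeft-A₁A₀∞ ∘ k ∘ (σ ⟨$⟩ˡ_))     ≈⟨ γ-∗-all-∞ʳ _ ℓ ℓ≡∞ ⟨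
  γ ((λ j → k (σ ⟨$⟩ˡ j)) ∗ ℓ)          ∎

isLast : ∀ {m} → Fin (suc m) → Bool
isLast {m} i = does (i ≟F fromℕ m)

isLast-reindex : ∀ {m} (σ : Permutation′ (suc m)) → σ ⟨$⟩ʳ fromℕ m ≡ fromℕ m →
  ∀ j → isLast (σ ⟨$⟩ˡ j) ≡ isLast j
isLast-reindex {m} σ fixed j = does-⇔ (mk⇔ toLast fromLast) (σ ⟨$⟩ˡ j ≟F fromℕ m) (j ≟F fromℕ m)
  where
  toLast : σ ⟨$⟩ˡ j ≡ fromℕ m → j ≡ fromℕ m
  toLast σj≡last = ≡.trans (≡.sym (inverseʳ σ)) (≡.trans (≡.cong (σ ⟨$⟩ʳ_) σj≡last) fixed)
  fromLast : j ≡ fromℕ m → σ ⟨$⟩ˡ j ≡ fromℕ m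
  fromLast ≡.refl = ≡.trans (≡.cong (σ ⟨$⟩ˡ_) (≡.sym fixed)) (inverseˡ σ)

-- v(ℓ) of the header for a block A₀^ℓ A₁^∞, and c(A₀^ℓ) for the final factor.
blockEntry-A₀A₁∞ : Bool → ℕ⁺∞ → FPS
blockEntry-A₀A₁∞ true ℓ = c (pow₀ ℓ)
blockEntry-A₀A₁∞ false ℓ = c (pow₀ ℓ) * b A₁∞ + d (pow₀ ℓ)

prod-∗-all-∞ˡ : ∀ {m} (k ℓ : Fin (suc m) → ℕ⁺∞) → (∀ i → k i ≡ ∞) →
  prodFrom₁ (k ∗ ℓ) ≡ A₁∞ ⊗ (pow₀ (ℓ 0F) ⊗ prodFrom₁ ((k ∘ sucF) ∗ (ℓ ∘ sucF)))
prod-∗-all-∞ˡ k ℓ k≡∞ = ≡.trans (≡.cong prodFrom₁ (∗-unfold k ℓ))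
  (≡.cong (λ t → pow₁ t ⊗ (pow₀ (ℓ 0F) ⊗ prodFrom₁ ((k ∘ sucF) ∗ (ℓ ∘ sucF)))) (k≡∞ 0F))

a-prod-∗-all-∞ˡ : ∀ {m} (k ℓ : Fin (suc m) → ℕ⁺∞) → (∀ i → k i ≡ ∞) →
  a (prodFrom₁ (k ∗ ℓ)) ≈ b A₁∞ * c (prodFrom₁ (k ∗ ℓ))
a-prod-∗-all-∞ˡ k ℓ k≡∞ = begin
  a (prodFrom₁ (k ∗ ℓ))           ≡⟨ ≡.cong a unfold ⟩
  a (A₁∞ ⊗ X)                     ≈⟨ a-A₁∞⊗ X ⟩
  b A₁∞ * c X                     ≈⟨ *-congˡ {b A₁∞} (c-A₁∞⊗ X) ⟨
  b A₁∞ * c (A₁∞ ⊗ X)             ≡⟨ ≡.cong (λ M → b A₁∞ * c M) unfold ⟨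
  b A₁∞ * c (prodFrom₁ (k ∗ ℓ))   ∎
  where
  X = pow₀ (ℓ 0F) ⊗ prodFrom₁ ((k ∘ sucF) ∗ (ℓ ∘ sucF))
  unfold = prod-∗-all-∞ˡ k ℓ k≡∞

c-prod-∗-all-∞ˡ : ∀ {m} (k ℓ : Fin (suc m) → ℕ⁺∞) → (∀ i → k i ≡ ∞) →
  c (prodFrom₁ (k ∗ ℓ)) ≈ ∏ (λ i → blockEntry-A₀A₁∞ (isLast i) (ℓ i))
c-prod-∗-all-∞ˡ {zero} k ℓ k≡∞ = begin
  c (prodFrom₁ (k ∗ ℓ))        ≡⟨ ≡.cong c (prod-∗-all-∞ˡ k ℓ k≡∞) ⟩
  c (A₁∞ ⊗ (P ⊗ I₂))           ≈⟨ c-A₁∞⊗ (P ⊗ I₂) ⟩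
  c (P ⊗ I₂)                   ≈⟨ c-⊗I₂ P ⟩
  c P                          ≈⟨ *-identityʳ (c P) ⟨
  c P * 1#                     ∎
  where
  P = pow₀ (ℓ 0F)
c-prod-∗-all-∞ˡ {suc m} k ℓ k≡∞ = begin
  c (prodFrom₁ (k ∗ ℓ))            ≡⟨ ≡.cong c (prod-∗-all-∞ˡ k ℓ k≡∞) ⟩
  c (A₁∞ ⊗ (P ⊗ M))                ≈⟨ c-A₁∞⊗ (P ⊗ M) ⟩
  c P * a M + d P * c M
    ≈⟨ +-congʳ {d P * c M} (*-congˡ {c P} (a-prod-∗-all-∞ˡ k′ ℓ′ (k≡∞ ∘ sucF))) ⟩
  c P * (b A₁∞ * c M) + d P * c M
    ≈⟨ +-congʳ {d P * c M} (*-assoc (c P) (b A₁∞) (c M)) ⟨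
  (c P * b A₁∞) * c M + d P * c M
    ≈⟨ distribʳ (c M) (c P * b A₁∞) (d P) ⟨
  blockEntry-A₀A₁∞ false (ℓ 0F) * c M
    ≈⟨ *-congˡ {blockEntry-A₀A₁∞ false (ℓ 0F)} (c-prod-∗-all-∞ˡ k′ ℓ′ (k≡∞ ∘ sucF)) ⟩
  ∏ (λ i → blockEntry-A₀A₁∞ (isLast i) (ℓ i)) ∎
  where
  k′ ℓ′ : Fin (suc m) → ℕ⁺∞
  k′ = k ∘ sucF
  ℓ′ = ℓ ∘ sucF
  P = pow₀ (ℓ 0F)
  M = prodFrom₁ (k′ ∗ ℓ′)

γ-∗-all-∞ˡ : ∀ {m} (k ℓ : Fin (suc m) → ℕ⁺∞) → (∀ i → k i ≡ ∞) →
  γ (k ∗ ℓ) ≈ b A₁∞ * ∏ (λ i → blockEntry-A₀A₁∞ (isLast i) (ℓ i))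
γ-∗-all-∞ˡ k ℓ k≡∞ = trans (a-prod-∗-all-∞ˡ k ℓ k≡∞) (*-congˡ {b A₁∞} (c-prod-∗-all-∞ˡ k ℓ k≡∞))

γ-∗-permuteʳ : ∀ {m} (k ℓ : Fin (suc m) → ℕ⁺∞) → (∀ i → k i ≡ ∞) →
  (σ : Permutation′ (suc m)) → σ ⟨$⟩ʳ fromℕ m ≡ fromℕ m →
  γ (k ∗ ℓ) ≈ γ (k ∗ (λ j → ℓ (σ ⟨$⟩ˡ j)))
γ-∗-permuteʳ {m} k ℓ k≡∞ σ fixed = begin
  γ (k ∗ ℓ)                      ≈⟨ γ-∗-all-∞ˡ k ℓ k≡∞ ⟩
  b A₁∞ * ∏ entry                ≈⟨ *-congˡ {b A₁∞} (∏-reindex entry σ) ⟨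
  b A₁∞ * ∏ (entry ∘ (σ ⟨$⟩ˡ_))
    ≡⟨ ≡.cong (b A₁∞ *_) (sum-cong-≗ {suc m} (λ j →
         ≡.cong (λ last → blockEntry-A₀A₁∞ last (ℓ (σ ⟨$⟩ˡ j))) (isLast-reindex σ fixed j))) ⟩
  b A₁∞ * ∏ (λ j → blockEntry-A₀A₁∞ (isLast j) (ℓ (σ ⟨$⟩ˡ j)))
    ≈⟨ γ-∗-all-∞ˡ k (λ j → ℓ (σ ⟨$⟩ˡ j)) k≡∞ ⟨
  γ (k ∗ (λ j → ℓ (σ ⟨$⟩ˡ j)))   ∎
  where
  entry : Fin (suc m) → FPS
  entry i = blockEntry-A₀A₁∞ (isLast i) (ℓ i)

corollary3p6 : (n : ℕ) (k ℓ : Fin (suc n) → ℕ⁺∞) →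
    (((∀ i → ℓ i ≡ ∞) → (σ : Permutation′ (suc n)) →
        γ (k ∗ ℓ) ≈ₛ γ ((λ j → k (σ ⟨$⟩ˡ j)) ∗ ℓ))
    × ((∀ i → k i ≡ ∞) → (σ : Permutation′ (suc n)) → σ ⟨$⟩ʳ fromℕ n ≡ fromℕ n →
        γ (k ∗ ℓ) ≈ₛ γ (k ∗ (λ j → ℓ (σ ⟨$⟩ˡ j)))))
corollary3p6 n k ℓ = γ-∗-permuteˡ k ℓ , γ-∗-permuteʳ k ℓ
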